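{- Let $n$ and $k$ be integers with $n\ge 4$ and $0\le k\le n-4$, and let $f(n,3)=\max_{0\le j\le n-4}\xi^c(G_{n,3,j})$. (i) If $n<7$, then $\xi^c(G_{n,3,k})\le f(n,3)=2n^2-5n+2$, with equality if and only if $k=n-4$. (ii) If $n>7$, then $\xi^c(G_{n,3,k})\le f(n,3)=3n^2-16n+30$, with equality if and only if $k=0$. (iii) If $n=7$, then $\xi^c(G_{7,3,k})=65$ for all $k=0,\ldots,3$.
   Context: For a connected graph $G=(V,E)$, $\mathrm{ecc}(v)=\max_{w\in V}\mathrm{dist}(v,w)$ and $\xi^c(G)=\sum_{v\in V}\deg(v)\,\mathrm{ecc}(v)$. For integers $n\ge4$, $3\le D\le n-1$, $0\le k\le n-D-1$, the graph $G_{n,D,k}$ is constructed from a path $u_0-u_1-\cdots-u_D$ and a disjoint clique $K_{n-D-1}$ by joining every vertex of the clique to $u_0$ and $u_1$, and joining $k$ of the clique vertices to $u_2$. -}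

module Defs where

open import Data.Nat.Base using (ℕ; zero; suc; _+_; _*_; _∸_; _⊔_; _≡ᵇ_; _<ᵇ_; _≤ᵇ_)
open import Data.Bool.Base using (Bool; true; false; _∧_; _∨_; not; if_then_else_)
open import Data.Fin.Base using (Fin; toℕ)
open import Data.List.Base using (List; map; foldr; allFin; upTo)
open import Data.Nat.ListAction using (sum)
open import Data.Bool.ListAction using (any)

-- A simple graph on the vertex set Fin n, given by a (symmetric, irreflexive)
-- Boolean adjacency function.
Graph : ℕ → Set
Graph n = Fin n → Fin n → Bool

deg : ∀ {n} → Graph n → Fin n → ℕ
deg {n} G v = sum (map (λ w → if G v w then 1 else 0) (allFin n))

reach : ∀ {n} → Graph n → ℕ → Fin n → Fin n → Bool
reach G zero    v w = toℕ v ≡ᵇ toℕ w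
reach {n} G (suc d) v w = reach G d v w ∨ any (λ u → reach G d v u ∧ G u w) (allFin n)

distSearch : ∀ {n} → Graph n → Fin n → Fin n → ℕ → ℕ → ℕ
distSearch G v w d zero     = d
distSearch G v w d (suc f)  = if reach G d v w then d else distSearch G v w (suc d) f

-- graph distance (shortest path length); for a connected graph on n vertices
-- the distance is < n, so searching d = 0 .. n-1 finds it exactly.
dist : ∀ {n} → Graph n → Fin n → Fin n → ℕ
dist {n} G v w = distSearch G v w 0 n

ecc : ∀ {n} → Graph n → Fin n → ℕ
ecc {n} G v = foldr _⊔_ 0 (map (dist G v) (allFin n))

ξc : ∀ {n} → Graph n → ℕ
ξc {n} G = sum (map (λ v → deg G v * ecc G v) (allFin n))

-- Vertex labelling (via toℕ):
--   i ∈ {0..D}        : path vertex u_i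
--   i ∈ {D+1..n-1}    : clique vertices (n-D-1 of them);
--   clique vertices D+1 .. D+k are the k ones joined to u_2.
private
  isPath isClique : ℕ → ℕ → ℕ → Bool
  isPath D i j = (i ≤ᵇ D) ∧ (j ≤ᵇ D) ∧ ((suc i ≡ᵇ j) ∨ (suc j ≡ᵇ i))
  isClique D i j = (D <ᵇ i) ∧ (D <ᵇ j) ∧ not (i ≡ᵇ j)

  cliquePath : ℕ → ℕ → ℕ → ℕ → Bool
  cliquePath D k c j = (D <ᵇ c) ∧ ((j ≡ᵇ 0) ∨ (j ≡ᵇ 1) ∨ ((j ≡ᵇ 2) ∧ (c <ᵇ suc (D + k))))

adjG : ℕ → ℕ → ℕ → ℕ → Bool
adjG D k i j = isPath D i j ∨ isClique D i j ∨ cliquePath D k i j ∨ cliquePath D k j i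

G : (n D k : ℕ) → Graph n
G n D k v w = adjG D k (toℕ v) (toℕ w)

f3 : ℕ → ℕ
f3 n = foldr _⊔_ 0 (map (λ j → ξc (G n 3 j)) (upTo (suc (n ∸ 4))))

module Submission where

-- Each vertex of G_{n,3,k} is a path vertex u₀,…,u₃ or a clique vertex, joined
-- to u₂ or not, and both adjacency and distance depend only on these six kinds.
-- A 6×6 distance table is certified by the breadth-first characterisation of
-- graph distance (distance 0 exactly on the diagonal, growth at most one along
-- an edge, and a neighbour one step closer for every other vertex), which gives
-- the eccentricities; counting neighbours kind by kind gives the degrees.  With
-- m = n − 4 clique vertices this yields ξ^c(G_{n,3,k}) = 3m² + 8m + 14 + (3 − m)k,
-- increasing, constant or decreasing in k according as n < 7, n = 7 or n > 7.

open import Defs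
open import Data.Bool.Base using (Bool; true; false; T; not; _∧_; if_then_else_)
open import Data.Bool.Properties using (T-∨; T-∧; T-≡; T?)
open import Data.Empty using (⊥-elim)
open import Data.Fin.Base using (Fin; toℕ; fromℕ<)
open import Data.Fin.Properties using (toℕ-injective; toℕ-fromℕ<; toℕ<n)
open import Data.List.Base using (List; []; _∷_; map; foldr; allFin; tabulate; upTo)
open import Data.List.Properties using (map-tabulate; map-cong)
open import Data.List.Membership.Propositional using (_∈_; lose)
open import Data.List.Membership.Propositional.Properties using (∈-allFin; ∈-upTo⁺; ∈-upTo⁻)
open import Data.List.Relation.Unary.All as All using ()
open import Data.List.Relation.Unary.Any as Any using (here; there)
open import Data.List.Relation.Unary.Any.Properties using (any⁺; any⁻)
open import Data.Nat.Base
open import Data.Nat.ListAction using (sum)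
open import Data.Nat.Properties
open import Data.Nat.Tactic.RingSolver using (solve-∀)
open import Data.Product.Base using (_×_; _,_; proj₁; proj₂; ∃-syntax)
open import Data.Sum.Base using (inj₁; inj₂)
open import Function.Base using (_∘_; id)
open import Function.Bundles using (_⇔_; mk⇔; Equivalence)
open import Relation.Binary.PropositionalEquality
open import Relation.Nullary.Negation using (¬_)
open import Relation.Nullary.Decidable
  using (Dec; yes; no; map′; toWitness; _→-dec_; _×-dec_; dec-true; dec-false)

open Equivalence using (to; from)

∑< : ℕ → (ℕ → ℕ) → ℕ
∑< zero    f = 0
∑< (suc n) f = f 0 + ∑< n (f ∘ suc)

sum-map-allFin : ∀ n (f : ℕ → ℕ) → sum (map (f ∘ toℕ) (allFin n)) ≡ ∑< n f
sum-map-allFin zero    f = refl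
sum-map-allFin (suc n) f = cong (f 0 +_) (begin
  sum (map (f ∘ toℕ) (tabulate {n = n} Fin.suc)) ≡⟨ cong sum (map-tabulate {n = n} Fin.suc (f ∘ toℕ)) ⟩
  sum (tabulate {n = n} (f ∘ suc ∘ toℕ))        ≡⟨ cong sum (map-tabulate {n = n} id (f ∘ suc ∘ toℕ)) ⟨
  sum (map (f ∘ suc ∘ toℕ) (allFin n))           ≡⟨ sum-map-allFin n (f ∘ suc) ⟩
  ∑< n (f ∘ suc)                                 ∎)
  where open ≡-Reasoning

∑<-cong : ∀ n {f g} → (∀ {i} → i < n → f i ≡ g i) → ∑< n f ≡ ∑< n g
∑<-cong zero    f≗g = refl
∑<-cong (suc n) f≗g = cong₂ _+_ (f≗g z<s) (∑<-cong n (f≗g ∘ s<s))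

∑<-const : ∀ n c → ∑< n (λ _ → c) ≡ n * c
∑<-const zero    c = refl
∑<-const (suc n) c = cong (c +_) (∑<-const n c)

∑<-+ : ∀ m n f → ∑< (m + n) f ≡ ∑< m f + ∑< n (f ∘ (m +_))
∑<-+ zero    n f = refl
∑<-+ (suc m) n f = trans (cong (f 0 +_) (∑<-+ m n (f ∘ suc))) (sym (+-assoc (f 0) _ _))

∑<-removeAt : ∀ n f {i} → i < n → ∑< n (λ j → if i ≡ᵇ j then 0 else f j) + f i ≡ ∑< n f
∑<-removeAt (suc n) f {zero}  _       = +-comm (∑< n (f ∘ suc)) (f 0)
∑<-removeAt (suc n) f {suc i} (s<s i<n) = begin
  f 0 + ∑< n (λ j → if i ≡ᵇ j then 0 else f (suc j)) + f (suc i)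
    ≡⟨ +-assoc (f 0) _ _ ⟩
  f 0 + (∑< n (λ j → if i ≡ᵇ j then 0 else f (suc j)) + f (suc i))
    ≡⟨ cong (f 0 +_) (∑<-removeAt n (f ∘ suc) i<n) ⟩
  f 0 + ∑< n (f ∘ suc) ∎
  where open ≡-Reasoning

module _ {A : Set} (g : A → ℕ) where

  foldr-⊔-lub : ∀ xs {c} → (∀ {x} → x ∈ xs → g x ≤ c) → foldr _⊔_ 0 (map g xs) ≤ c
  foldr-⊔-lub []       _     = z≤n
  foldr-⊔-lub (x ∷ xs) bound = ⊔-lub (bound (here refl)) (foldr-⊔-lub xs (bound ∘ there))

  foldr-⊔-upper : ∀ {x xs} → x ∈ xs → g x ≤ foldr _⊔_ 0 (map g xs)
  foldr-⊔-upper {xs = y ∷ _} (here refl) = m≤m⊔n (g y) _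
  foldr-⊔-upper {xs = y ∷ _} (there x∈xs) = ≤-trans (foldr-⊔-upper x∈xs) (m≤n⊔m (g y) _)

  foldr-⊔-attained : ∀ xs {x₀} → x₀ ∈ xs → (∀ {x} → x ∈ xs → g x ≤ g x₀) →
                     foldr _⊔_ 0 (map g xs) ≡ g x₀
  foldr-⊔-attained xs x₀∈xs bound = ≤-antisym (foldr-⊔-lub xs bound) (foldr-⊔-upper x₀∈xs)

-- Graph distance from a breadth-first layering

record IsGraphDistance {n} (G : Graph n) (δ : Fin n → Fin n → ℕ) : Set where
  field
    δ-refl   : ∀ v → δ v v ≡ 0
    δ≡0⇒≡    : ∀ {v w} → δ v w ≡ 0 → v ≡ w
    δ-step   : ∀ {v u w} → T (G u w) → δ v w ≤ suc (δ v u)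
    δ-parent : ∀ {v w} → 0 < δ v w → ∃[ u ] T (G u w) × suc (δ v u) ≡ δ v w

module _ {n} {G : Graph n} {δ : Fin n → Fin n → ℕ} (isDist : IsGraphDistance G δ) where
  open IsGraphDistance isDist

  reach⇔ : ∀ d v w → T (reach G d v w) ⇔ δ v w ≤ d
  reach⇔ zero v w = mk⇔
    (λ v≈w → ≤-reflexive (trans (cong (δ v) (sym (toℕ-injective (≡ᵇ⇒≡ _ _ v≈w)))) (δ-refl v)))
    (λ δ≤0 → ≡⇒≡ᵇ _ _ (cong toℕ (δ≡0⇒≡ (n≤0⇒n≡0 δ≤0))))
  reach⇔ (suc d) v w = mk⇔ reached unreached
    where
    reached : T (reach G (suc d) v w) → δ v w ≤ suc d
    reached r with to T-∨ r
    ... | inj₁ reach-w = m≤n⇒m≤1+n (to (reach⇔ d v w) reach-w)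
    ... | inj₂ via-u with Any.satisfied (any⁻ _ (allFin n) via-u)
    ...   | u , reach-u∧u~w with to T-∧ reach-u∧u~w
    ...     | reach-u , u~w = ≤-trans (δ-step u~w) (s≤s (to (reach⇔ d v u) reach-u))
    unreached : δ v w ≤ suc d → T (reach G (suc d) v w)
    unreached δ≤1+d with δ v w ≤? d
    ... | yes δ≤d = from T-∨ (inj₁ (from (reach⇔ d v w) δ≤d))
    ... | no  δ≰d with δ-parent (<-≤-trans z<s (≰⇒> δ≰d))
    ...   | u , u~w , 1+δu≡δ = from T-∨ (inj₂ (any⁺ _ (lose (∈-allFin u)
              (from T-∧ (from (reach⇔ d v u) δu≤d , u~w)))))
      where
      δu≤d : δ v u ≤ d
      δu≤d = s≤s⁻¹ (subst (_≤ suc d) (sym 1+δu≡δ) δ≤1+d)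

  distSearch≡ : ∀ v w d f → d ≤ δ v w → δ v w < d + f → distSearch G v w d f ≡ δ v w
  distSearch≡ v w d zero    d≤δ δ<d+0 = ⊥-elim (<⇒≱ (subst (δ v w <_) (+-identityʳ d) δ<d+0) d≤δ)
  distSearch≡ v w d (suc f) d≤δ δ<d+f with reach G d v w in r
  ... | true  = ≤-antisym d≤δ (to (reach⇔ d v w) (subst T (sym r) _))
  ... | false = distSearch≡ v w (suc d) f (≰⇒> δ≰d) (subst (δ v w <_) (+-suc d f) δ<d+f)
    where
    δ≰d : ¬ δ v w ≤ d
    δ≰d δ≤d = subst T r (from (reach⇔ d v w) δ≤d)

  dist≡ : (∀ v w → δ v w < n) → ∀ v w → dist G v w ≡ δ v w
  dist≡ δ<n v w = distSearch≡ v w 0 n z≤n (δ<n v w)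

-- Distances in G_{n,3,k}

data Kind : Set where
  u₀ u₁ u₂ u₃ c⁺ c⁻ : Kind

kind : ℕ → ℕ → Kind
kind k 0 = u₀
kind k 1 = u₁
kind k 2 = u₂
kind k 3 = u₃
kind k (suc (suc (suc (suc x)))) = if x <ᵇ k then c⁺ else c⁻

adjacent : Kind → Kind → Bool
adjacent u₀ u₁ = true
adjacent u₀ c⁺ = true
adjacent u₀ c⁻ = true
adjacent u₁ u₀ = true
adjacent u₁ u₂ = true
adjacent u₁ c⁺ = true
adjacent u₁ c⁻ = true
adjacent u₂ u₁ = true
adjacent u₂ u₃ = true
adjacent u₂ c⁺ = true
adjacent u₃ u₂ = true
adjacent c⁺ u₃ = false
adjacent c⁺ _  = true
adjacent c⁻ u₂ = false
adjacent c⁻ u₃ = false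
adjacent c⁻ _  = true
adjacent _  _  = false

adjG-kind : ∀ k i j → adjG 3 k i j ≡ not (i ≡ᵇ j) ∧ adjacent (kind k i) (kind k j)
adjG-kind k 0 0 = refl
adjG-kind k 0 1 = refl
adjG-kind k 0 2 = refl
adjG-kind k 0 3 = refl
adjG-kind k 1 0 = refl
adjG-kind k 1 1 = refl
adjG-kind k 1 2 = refl
adjG-kind k 1 3 = refl
adjG-kind k 2 0 = refl
adjG-kind k 2 1 = refl
adjG-kind k 2 2 = refl
adjG-kind k 2 3 = refl
adjG-kind k 3 0 = refl
adjG-kind k 3 1 = refl
adjG-kind k 3 2 = refl
adjG-kind k 3 3 = refl
adjG-kind k 0 (suc (suc (suc (suc y)))) with y <ᵇ k
... | true  = refl
... | false = refl
adjG-kind k 1 (suc (suc (suc (suc y)))) with y <ᵇ k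
... | true  = refl
... | false = refl
adjG-kind k 2 (suc (suc (suc (suc y)))) with y <ᵇ k
... | true  = refl
... | false = refl
adjG-kind k 3 (suc (suc (suc (suc y)))) with y <ᵇ k
... | true  = refl
... | false = refl
adjG-kind k (suc (suc (suc (suc x)))) 0 with x <ᵇ k
... | true  = refl
... | false = refl
adjG-kind k (suc (suc (suc (suc x)))) 1 with x <ᵇ k
... | true  = refl
... | false = refl
adjG-kind k (suc (suc (suc (suc x)))) 2 with x <ᵇ k
... | true  = refl
... | false = refl
adjG-kind k (suc (suc (suc (suc x)))) 3 with x <ᵇ k
... | true  = refl
... | false = refl
adjG-kind k (suc (suc (suc (suc x)))) (suc (suc (suc (suc y)))) with x ≡ᵇ y | x <ᵇ k | y <ᵇ k
... | true  | _     | _     = refl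
... | false | true  | true  = refl
... | false | true  | false = refl
... | false | false | true  = refl
... | false | false | false = refl

-- Two distinct
-- vertices never share one of the singleton kinds uᵢ; the value 2 chosen
-- there is only what makes the exhaustive checks below hold uniformly.
distance : Kind → Kind → ℕ
distance u₀ u₀ = 2
distance u₁ u₁ = 2
distance u₂ u₂ = 2
distance u₃ u₃ = 2
distance u₀ u₂ = 2
distance u₀ u₃ = 3
distance u₁ u₃ = 2
distance u₂ u₀ = 2
distance u₂ c⁻ = 2
distance u₃ u₀ = 3
distance u₃ u₁ = 2
distance u₃ c⁺ = 2
distance u₃ c⁻ = 3
distance c⁺ u₃ = 2
distance c⁻ u₂ = 2
distance c⁻ u₃ = 3
distance _  _  = 1

eccentricity : Kind → ℕ
eccentricity u₀ = 3
eccentricity u₁ = 2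
eccentricity u₂ = 2
eccentricity u₃ = 3
eccentricity c⁺ = 2
eccentricity c⁻ = 3

-- The path vertex (u₁ or u₂) through which some shortest path of length ≥ 2
-- enters a vertex of the given kind.
parent : Kind → ℕ
parent u₁ = 2
parent u₃ = 2
parent c⁺ = 2
parent _  = 1

farthest : Kind → ℕ
farthest u₂ = 0
farthest u₃ = 0
farthest _  = 3

kind-farthest≢ : ∀ k κ → kind k (farthest κ) ≢ κ
kind-farthest≢ k u₀ ()
kind-farthest≢ k u₁ ()
kind-farthest≢ k u₂ ()
kind-farthest≢ k u₃ ()
kind-farthest≢ k c⁺ ()
kind-farthest≢ k c⁻ ()

kinds : List Kind
kinds = u₀ ∷ u₁ ∷ u₂ ∷ u₃ ∷ c⁺ ∷ c⁻ ∷ []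

∈-kinds : ∀ κ → κ ∈ kinds
∈-kinds u₀ = here refl
∈-kinds u₁ = there (here refl)
∈-kinds u₂ = there (there (here refl))
∈-kinds u₃ = there (there (there (here refl)))
∈-kinds c⁺ = there (there (there (there (here refl))))
∈-kinds c⁻ = there (there (there (there (there (here refl)))))

∀-kind? : {P : Kind → Set} → (∀ κ → Dec (P κ)) → Dec (∀ κ → P κ)
∀-kind? P? =
  map′ (λ all κ → All.lookup all (∈-kinds κ)) (λ p → All.tabulate (λ {κ} _ → p κ)) (All.all? P? kinds)

distance-pos : ∀ κ κ' → 0 < distance κ κ'
distance-pos = toWitness {a? = ∀-kind? λ κ → ∀-kind? λ κ' → 0 <? distance κ κ'} _

adjacent⇒distance≤1 : ∀ κ κ' → T (adjacent κ κ') → distance κ κ' ≤ 1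
adjacent⇒distance≤1 = toWitness {a? = ∀-kind? λ κ → ∀-kind? λ κ' →
  T? (adjacent κ κ') →-dec distance κ κ' ≤? 1} _

distance≡1⇒adjacent : ∀ κ κ' → distance κ κ' ≡ 1 → T (adjacent κ κ')
distance≡1⇒adjacent = toWitness {a? = ∀-kind? λ κ → ∀-kind? λ κ' →
  distance κ κ' ≟ 1 →-dec T? (adjacent κ κ')} _

distance-step : ∀ κ κ' κ'' → T (adjacent κ'' κ') → distance κ κ' ≤ suc (distance κ κ'')
distance-step = toWitness {a? = ∀-kind? λ κ → ∀-kind? λ κ' → ∀-kind? λ κ'' →
  T? (adjacent κ'' κ') →-dec distance κ κ' ≤? suc (distance κ κ'')} _

distance-parent : ∀ k κ κ' → 2 ≤ distance κ κ' →
  parent κ' ≤ 3 × T (adjacent (kind k (parent κ')) κ') × suc (distance κ (kind k (parent κ'))) ≡ distance κ κ'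
distance-parent k = toWitness {a? = ∀-kind? λ κ → ∀-kind? λ κ' → 2 ≤? distance κ κ' →-dec
  (parent κ' ≤? 3 ×-dec T? (adjacent (kind k (parent κ')) κ') ×-dec
   suc (distance κ (kind k (parent κ'))) ≟ distance κ κ')} _

distance≤eccentricity : ∀ κ κ' → distance κ κ' ≤ eccentricity κ
distance≤eccentricity = toWitness {a? = ∀-kind? λ κ → ∀-kind? λ κ' → distance κ κ' ≤? eccentricity κ} _

eccentricity≤3 : ∀ κ → eccentricity κ ≤ 3
eccentricity≤3 = toWitness {a? = ∀-kind? λ κ → eccentricity κ ≤? 3} _

distance-farthest : ∀ k κ → farthest κ ≤ 3 × distance κ (kind k (farthest κ)) ≡ eccentricity κ
distance-farthest k = toWitness {a? = ∀-kind? λ κ →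
  farthest κ ≤? 3 ×-dec distance κ (kind k (farthest κ)) ≟ eccentricity κ} _

adjG⇔ : ∀ k {u j} → T (adjG 3 k u j) ⇔ (u ≢ j × T (adjacent (kind k u) (kind k j)))
adjG⇔ k {u} {j} rewrite adjG-kind k u j = mk⇔
  (λ u-j → let u≢ᵇj , u~j = to T-∧ u-j in (λ u≡j → subst (T ∘ not) (to T-≡ (≡⇒≡ᵇ u j u≡j)) u≢ᵇj) , u~j)
  (λ (u≢j , u~j) → from T-∧ (subst (T ∘ not) (sym (dec-false (u ≟ j) u≢j)) _ , u~j))

dist₃ : ℕ → ℕ → ℕ → ℕ
dist₃ k i j = if i ≡ᵇ j then 0 else distance (kind k i) (kind k j)

module _ (k : ℕ) where

  dist₃-refl : ∀ i → dist₃ k i i ≡ 0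
  dist₃-refl i rewrite dec-true (i ≟ i) refl = refl

  dist₃-≢ : ∀ {i j} → i ≢ j → dist₃ k i j ≡ distance (kind k i) (kind k j)
  dist₃-≢ {i} {j} i≢j rewrite dec-false (i ≟ j) i≢j = refl

  dist₃≡0⇒≡ : ∀ {i j} → dist₃ k i j ≡ 0 → i ≡ j
  dist₃≡0⇒≡ {i} {j} δ≡0 with i ≟ j
  ... | yes i≡j = i≡j
  ... | no  i≢j = ⊥-elim (<-irrefl (sym (trans (sym (dist₃-≢ i≢j)) δ≡0)) (distance-pos _ _))

  dist₃-step : ∀ {i u j} → T (adjG 3 k u j) → dist₃ k i j ≤ suc (dist₃ k i u)
  dist₃-step {i} {u} {j} u-j with _ , u~j ← to (adjG⇔ k {u} {j}) u-j | i ≟ j | i ≟ u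
  ... | yes refl | _        = subst (_≤ suc (dist₃ k i u)) (sym (dist₃-refl i)) z≤n
  ... | no  i≢j  | yes refl = subst₂ (λ a b → a ≤ suc b) (sym (dist₃-≢ i≢j)) (sym (dist₃-refl i))
                                     (adjacent⇒distance≤1 _ _ u~j)
  ... | no  i≢j  | no  i≢u  = subst₂ (λ a b → a ≤ suc b) (sym (dist₃-≢ i≢j)) (sym (dist₃-≢ i≢u))
                                     (distance-step _ _ _ u~j)

  dist₃-parent : ∀ {n i j} → 4 ≤ n → i < n → 0 < dist₃ k i j →
                 ∃[ u ] u < n × T (adjG 3 k u j) × suc (dist₃ k i u) ≡ dist₃ k i j
  dist₃-parent {n} {i} {j} 4≤n i<n δ>0 with i ≟ j
  ... | yes refl = ⊥-elim (<-irrefl (sym (dist₃-refl i)) δ>0)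
  ... | no  i≢j with distance (kind k i) (kind k j) ≤? 1
  ...   | yes d≤1 = i , i<n , from (adjG⇔ k) (i≢j , distance≡1⇒adjacent _ _ d≡1) ,
                    trans (cong suc (dist₃-refl i)) (trans (sym d≡1) (sym (dist₃-≢ i≢j)))
    where
    d≡1 : distance (kind k i) (kind k j) ≡ 1
    d≡1 = ≤-antisym d≤1 (distance-pos _ _)
  ...   | no  d≰1 with distance-parent k (kind k i) (kind k j) (≰⇒> d≰1)
  ...     | p≤3 , p~j , 1+dp≡d = p , ≤-<-trans p≤3 4≤n , from (adjG⇔ k) (p≢j , p~j) ,
                                 trans (cong suc (dist₃-≢ i≢p)) (trans 1+dp≡d (sym (dist₃-≢ i≢j)))
    where
    p = parent (kind k j)
    i≢p : i ≢ p
    i≢p refl = d≰1 (adjacent⇒distance≤1 _ _ p~j)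
    p≢j : p ≢ j
    p≢j p≡j = <-irrefl (cong (λ x → distance (kind k i) (kind k x)) p≡j) (≤-reflexive 1+dp≡d)

  dist₃≤eccentricity : ∀ i j → dist₃ k i j ≤ eccentricity (kind k i)
  dist₃≤eccentricity i j with i ≟ j
  ... | yes refl = subst (_≤ eccentricity (kind k i)) (sym (dist₃-refl i)) z≤n
  ... | no  i≢j  = subst (_≤ eccentricity (kind k i)) (sym (dist₃-≢ i≢j)) (distance≤eccentricity _ _)

  dist₃-farthest : ∀ i → dist₃ k i (farthest (kind k i)) ≡ eccentricity (kind k i)
  dist₃-farthest i = trans (dist₃-≢ i≢far) (proj₂ (distance-farthest k (kind k i)))
    where
    i≢far : i ≢ farthest (kind k i)
    i≢far i≡far = kind-farthest≢ k (kind k i) (sym (cong (kind k) i≡far))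

module _ (k : ℕ) {n} (4≤n : 4 ≤ n) where

  private
    δ : Fin n → Fin n → ℕ
    δ v w = dist₃ k (toℕ v) (toℕ w)

  isGraphDistance : IsGraphDistance (G n 3 k) δ
  isGraphDistance = record
    { δ-refl   = λ v → dist₃-refl k (toℕ v)
    ; δ≡0⇒≡    = λ δ≡0 → toℕ-injective (dist₃≡0⇒≡ k δ≡0)
    ; δ-step   = λ {v} → dist₃-step k {toℕ v}
    ; δ-parent = λ {v} {w} → has-parent {v} {w}
    }
    where
    has-parent : ∀ {v w} → 0 < δ v w → ∃[ u ] T (G n 3 k u w) × suc (δ v u) ≡ δ v w
    has-parent {v} {w} δ>0 with dist₃-parent k 4≤n (toℕ<n v) δ>0
    ... | u , u<n , u~w , 1+δu≡δ = fromℕ< u<n ,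
      subst (λ x → T (adjG 3 k x (toℕ w)) × suc (dist₃ k (toℕ v) x) ≡ δ v w)
            (sym (toℕ-fromℕ< u<n)) (u~w , 1+δu≡δ)

  dist-G : ∀ v w → dist (G n 3 k) v w ≡ dist₃ k (toℕ v) (toℕ w)
  dist-G = dist≡ isGraphDistance
    (λ v w → ≤-<-trans (≤-trans (dist₃≤eccentricity k (toℕ v) (toℕ w)) (eccentricity≤3 _)) 4≤n)

  ecc-G : ∀ v → ecc (G n 3 k) v ≡ eccentricity (kind k (toℕ v))
  ecc-G v = trans (foldr-⊔-attained (dist (G n 3 k) v) (allFin n) (∈-allFin far) farthest-bound) dist-far
    where
    κ = kind k (toℕ v)
    far : Fin n
    far = fromℕ< (≤-<-trans (proj₁ (distance-farthest k κ)) 4≤n)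
    dist-far : dist (G n 3 k) v far ≡ eccentricity κ
    dist-far = trans (dist-G v far) (subst (λ x → dist₃ k (toℕ v) x ≡ eccentricity κ)
                                           (sym (toℕ-fromℕ< _)) (dist₃-farthest k (toℕ v)))
    farthest-bound : ∀ {w} → w ∈ allFin n → dist (G n 3 k) v w ≤ dist (G n 3 k) v far
    farthest-bound {w} _ = subst₂ _≤_ (sym (dist-G v w)) (sym dist-far) (dist₃≤eccentricity k (toℕ v) (toℕ w))

-- Degrees and ξ^c

𝟙 : Bool → ℕ
𝟙 b = if b then 1 else 0

𝟙-not-∧ : ∀ b c → 𝟙 (not b ∧ c) ≡ (if b then 0 else 𝟙 c)
𝟙-not-∧ true  c = refl
𝟙-not-∧ false c = refl

degree : ℕ → ℕ → Kind → ℕ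
degree k l u₀ = 1 + (k + l)
degree k l u₁ = 2 + (k + l)
degree k l u₂ = 2 + k
degree k l u₃ = 1
degree k l c⁺ = 2 + (k + l)
degree k l c⁻ = 1 + (k + l)

module _ (k l : ℕ) where

  sumOverKinds : (Kind → ℕ) → ℕ
  sumOverKinds f = f u₀ + (f u₁ + (f u₂ + (f u₃ + (k * f c⁺ + l * f c⁻))))

  ∑<-kind : ∀ f → ∑< (4 + (k + l)) (f ∘ kind k) ≡ sumOverKinds f
  ∑<-kind f = cong (λ s → f u₀ + (f u₁ + (f u₂ + (f u₃ + s)))) (begin
    ∑< (k + l) (f ∘ kind k ∘ (4 +_))
      ≡⟨ ∑<-+ k l _ ⟩
    ∑< k (f ∘ kind k ∘ (4 +_)) + ∑< l (f ∘ kind k ∘ (4 +_) ∘ (k +_))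
      ≡⟨ cong₂ _+_ (∑<-cong k joined) (∑<-cong l unjoined) ⟩
    ∑< k (λ _ → f c⁺) + ∑< l (λ _ → f c⁻)
      ≡⟨ cong₂ _+_ (∑<-const k (f c⁺)) (∑<-const l (f c⁻)) ⟩
    k * f c⁺ + l * f c⁻ ∎)
    where
    open ≡-Reasoning
    joined : ∀ {x} → x < k → f (kind k (4 + x)) ≡ f c⁺
    joined {x} x<k rewrite dec-true (x <? k) x<k = refl
    unjoined : ∀ {x} → x < l → f (kind k (4 + (k + x))) ≡ f c⁻
    unjoined {x} _ rewrite dec-false (k + x <? k) (m+n≮m k x) = refl

  degree-count : ∀ κ → degree k l κ + 𝟙 (adjacent κ κ) ≡ sumOverKinds (𝟙 ∘ adjacent κ)
  degree-count u₀ rewrite *-identityʳ k | *-identityʳ l = +-identityʳ _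
  degree-count u₁ rewrite *-identityʳ k | *-identityʳ l = +-identityʳ _
  degree-count u₂ rewrite *-identityʳ k | *-zeroʳ l = refl
  degree-count u₃ rewrite *-zeroʳ k | *-zeroʳ l = refl
  degree-count c⁺ rewrite *-identityʳ k | *-identityʳ l = cong (2 +_) (+-comm (k + l) 1)
  degree-count c⁻ rewrite *-identityʳ k | *-identityʳ l = cong (1 +_) (+-comm (k + l) 1)

  deg-G : ∀ v → deg (G (4 + (k + l)) 3 k) v ≡ degree k l (kind k (toℕ v))
  deg-G v = +-cancelʳ-≡ _ _ _ (begin
    deg (G (4 + (k + l)) 3 k) v + 𝟙 (adjacent κ κ)
      ≡⟨ cong (_+ 𝟙 (adjacent κ κ)) (sum-map-allFin (4 + (k + l)) (𝟙 ∘ adjG 3 k i)) ⟩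
    ∑< (4 + (k + l)) (𝟙 ∘ adjG 3 k i) + 𝟙 (adjacent κ κ)
      ≡⟨ cong (_+ 𝟙 (adjacent κ κ)) (∑<-cong (4 + (k + l)) (λ {j} _ → kinded j)) ⟩
    ∑< (4 + (k + l)) (λ j → if i ≡ᵇ j then 0 else 𝟙 (adjacent κ (kind k j))) + 𝟙 (adjacent κ κ)
      ≡⟨ ∑<-removeAt (4 + (k + l)) (𝟙 ∘ adjacent κ ∘ kind k) (toℕ<n v) ⟩
    ∑< (4 + (k + l)) (𝟙 ∘ adjacent κ ∘ kind k)
      ≡⟨ ∑<-kind (𝟙 ∘ adjacent κ) ⟩
    sumOverKinds (𝟙 ∘ adjacent κ)
      ≡⟨ degree-count κ ⟨
    degree k l κ + 𝟙 (adjacent κ κ) ∎)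
    where
    open ≡-Reasoning
    i = toℕ v
    κ = kind k i
    kinded : ∀ j → 𝟙 (adjG 3 k i j) ≡ (if i ≡ᵇ j then 0 else 𝟙 (adjacent κ (kind k j)))
    kinded j = trans (cong 𝟙 (adjG-kind k i j)) (𝟙-not-∧ (i ≡ᵇ j) (adjacent κ (kind k j)))

  contribution : Kind → ℕ
  contribution κ = degree k l κ * eccentricity κ

  ξc-G : ξc (G (4 + (k + l)) 3 k) ≡ sumOverKinds contribution
  ξc-G = begin
    ξc (G (4 + (k + l)) 3 k)
      ≡⟨ cong sum (map-cong (λ v → cong₂ _*_ (deg-G v) (ecc-G k (m≤m+n 4 (k + l)) v)) (allFin (4 + (k + l)))) ⟩
    sum (map (contribution ∘ kind k ∘ toℕ) (allFin (4 + (k + l))))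
      ≡⟨ sum-map-allFin (4 + (k + l)) (contribution ∘ kind k) ⟩
    ∑< (4 + (k + l)) (contribution ∘ kind k)
      ≡⟨ ∑<-kind contribution ⟩
    sumOverKinds contribution ∎
    where open ≡-Reasoning

-- ξ^c(G_{n,3,k}) as a function of k

-- m = n − 4 is the number of clique vertices.
ξ₃ : ℕ → ℕ → ℕ
ξ₃ m k = ξc (G (4 + m) 3 k)

-- ξ₃ m k = 3m² + 8m + 14 + (3 − m)k, with the term k·m moved across to avoid subtraction.
ξ₃-affine : ∀ {m k} → k ≤ m → ξ₃ m k + k * m ≡ 3 * m * m + 8 * m + 14 + 3 * k
ξ₃-affine {m} {k} k≤m =
  subst (λ m → ξ₃ m k + k * m ≡ 3 * m * m + 8 * m + 14 + 3 * k) (m+[n∸m]≡n k≤m)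
  (trans (cong (_+ k * (k + l)) (ξc-G k l)) (polynomial k l))
  where
  l = m ∸ k
  polynomial : ∀ k l →
    (1 + (k + l)) * 3 + ((2 + (k + l)) * 2 + ((2 + k) * 2 + (1 * 3 + (k * ((2 + (k + l)) * 2) + l * ((1 + (k + l)) * 3)))))
      + k * (k + l) ≡ 3 * (k + l) * (k + l) + 8 * (k + l) + 14 + 3 * k
  polynomial = solve-∀

ξ₃-0 : ∀ m → ξ₃ m 0 ≡ 3 * m * m + 8 * m + 14
ξ₃-0 m = +-cancelʳ-≡ 0 _ _ (ξ₃-affine {m} z≤n)

ξ₃-decreasing : ∀ {m j} → 3 ≤ m → j ≤ m → ξ₃ m j + j * (m ∸ 3) ≡ ξ₃ m 0
ξ₃-decreasing {m} {j} 3≤m =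
  subst (λ x → j ≤ x → ξ₃ x j + j * (m ∸ 3) ≡ ξ₃ x 0) (m+[n∸m]≡n 3≤m) (split-at-3 (m ∸ 3))
  where
  open ≡-Reasoning
  rearrange : ∀ x j p → x + j * p + 3 * j ≡ x + j * (3 + p)
  rearrange = solve-∀
  split-at-3 : ∀ p → j ≤ 3 + p → ξ₃ (3 + p) j + j * p ≡ ξ₃ (3 + p) 0
  split-at-3 p j≤3+p = +-cancelʳ-≡ (3 * j) _ _ (begin
    ξ₃ (3 + p) j + j * p + 3 * j                      ≡⟨ rearrange (ξ₃ (3 + p) j) j p ⟩
    ξ₃ (3 + p) j + j * (3 + p)                        ≡⟨ ξ₃-affine {3 + p} {j} j≤3+p ⟩
    3 * (3 + p) * (3 + p) + 8 * (3 + p) + 14 + 3 * j  ≡⟨ cong (_+ 3 * j) (ξ₃-0 (3 + p)) ⟨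
    ξ₃ (3 + p) 0 + 3 * j                              ∎)

ξ₃-increasing : ∀ {m j} e → m + e ≡ 3 → j ≤ m → ξ₃ m j + (m ∸ j) * e ≡ ξ₃ m m
ξ₃-increasing {m} {j} e m+e≡3 j≤m =
  subst (λ x → x + e ≡ 3 → ξ₃ x j + (m ∸ j) * e ≡ ξ₃ x x) (m+[n∸m]≡n j≤m) (split-at-j (m ∸ j)) m+e≡3
  where
  open ≡-Reasoning
  rearrange : ∀ x j d e → x + d * e + (j + d) * (j + d) ≡ x + j * (j + d) + d * (j + d + e)
  rearrange = solve-∀
  regroup : ∀ P j d → P + 3 * j + d * 3 ≡ P + 3 * (j + d)
  regroup = solve-∀
  split-at-j : ∀ d → j + d + e ≡ 3 → ξ₃ (j + d) j + d * e ≡ ξ₃ (j + d) (j + d)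
  split-at-j d j+d+e≡3 = +-cancelʳ-≡ ((j + d) * (j + d)) _ _ (begin
    ξ₃ (j + d) j + d * e + (j + d) * (j + d)
      ≡⟨ rearrange (ξ₃ (j + d) j) j d e ⟩
    ξ₃ (j + d) j + j * (j + d) + d * (j + d + e)
      ≡⟨ cong₂ _+_ (ξ₃-affine {j + d} {j} (m≤m+n j d)) (cong (d *_) j+d+e≡3) ⟩
    P + 3 * j + d * 3
      ≡⟨ regroup P j d ⟩
    P + 3 * (j + d)
      ≡⟨ ξ₃-affine {j + d} {j + d} ≤-refl ⟨
    ξ₃ (j + d) (j + d) + (j + d) * (j + d) ∎)
    where
    P = 3 * (j + d) * (j + d) + 8 * (j + d) + 14

+-*-gap : ∀ {x y} d {c} → 0 < c → x + d * c ≡ y → x ≤ y × (x ≡ y ⇔ d ≡ 0)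
+-*-gap {x} d {c} c>0 x+dc≡y = subst (x ≤_) x+dc≡y (m≤m+n x _) , mk⇔
  (λ x≡y → m*n≡0⇒m≡0 d c {{>-nonZero c>0}}
             (+-cancelˡ-≡ x _ 0 (trans x+dc≡y (trans (sym x≡y) (sym (+-identityʳ x))))))
  (λ { refl → trans (sym (+-identityʳ x)) x+dc≡y })

f3-attained : ∀ {m j₀} → j₀ ≤ m → (∀ {j} → j ≤ m → ξ₃ m j ≤ ξ₃ m j₀) → f3 (4 + m) ≡ ξ₃ m j₀
f3-attained {m} j₀≤m bound =
  foldr-⊔-attained (ξ₃ m) (upTo (suc m)) (∈-upTo⁺ (s≤s j₀≤m)) (λ j∈ → bound (s≤s⁻¹ (∈-upTo⁻ j∈)))

m+n≡o⇒m≡o∸n : ∀ {m n o} → m + n ≡ o → m ≡ o ∸ n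
m+n≡o⇒m≡o∸n {m} {n} refl = sym (m+n∸n≡m m n)

ξ₃-m-closed : ∀ m → ξ₃ m m ≡ 2 * (4 + m) * (4 + m) + 2 ∸ 5 * (4 + m)
ξ₃-m-closed m = m+n≡o⇒m≡o∸n (+-cancelʳ-≡ (m * m) _ _ (begin
  ξ₃ m m + 5 * (4 + m) + m * m   ≡⟨ rearrange (ξ₃ m m) m ⟩
  ξ₃ m m + m * m + 5 * (4 + m)   ≡⟨ cong (_+ 5 * (4 + m)) (ξ₃-affine {m} {m} ≤-refl) ⟩
  3 * m * m + 8 * m + 14 + 3 * m + 5 * (4 + m) ≡⟨ polynomial m ⟩
  2 * (4 + m) * (4 + m) + 2 + m * m ∎))
  where
  open ≡-Reasoning
  rearrange : ∀ x m → x + 5 * (4 + m) + m * m ≡ x + m * m + 5 * (4 + m)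
  rearrange = solve-∀
  polynomial : ∀ m → 3 * m * m + 8 * m + 14 + 3 * m + 5 * (4 + m) ≡ 2 * (4 + m) * (4 + m) + 2 + m * m
  polynomial = solve-∀

ξ₃-0-closed : ∀ m → ξ₃ m 0 ≡ 3 * (4 + m) * (4 + m) + 30 ∸ 16 * (4 + m)
ξ₃-0-closed m = m+n≡o⇒m≡o∸n (trans (cong (_+ 16 * (4 + m)) (ξ₃-0 m)) (polynomial m))
  where
  polynomial : ∀ m → 3 * m * m + 8 * m + 14 + 16 * (4 + m) ≡ 3 * (4 + m) * (4 + m) + 30
  polynomial = solve-∀

below-7 : ∀ {m k} → m < 3 → k ≤ m →
  ξ₃ m k ≤ f3 (4 + m) × f3 (4 + m) ≡ 2 * (4 + m) * (4 + m) + 2 ∸ 5 * (4 + m) × (ξ₃ m k ≡ f3 (4 + m) ⇔ k ≡ m)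
below-7 {m} {k} m<3 k≤m =
  subst (ξ₃ m k ≤_) (sym f3≡ξ₃mm) (proj₁ (gap k≤m)) , trans f3≡ξ₃mm (ξ₃-m-closed m) , mk⇔
    (λ ξ≡f3 → ≤-antisym k≤m (m∸n≡0⇒m≤n (to (proj₂ (gap k≤m)) (trans ξ≡f3 f3≡ξ₃mm))))
    (λ { refl → trans (from (proj₂ (gap k≤m)) (n∸n≡0 k)) (sym f3≡ξ₃mm) })
  where
  gap : ∀ {j} → j ≤ m → ξ₃ m j ≤ ξ₃ m m × (ξ₃ m j ≡ ξ₃ m m ⇔ m ∸ j ≡ 0)
  gap {j} j≤m = +-*-gap (m ∸ j) (m<n⇒0<n∸m m<3) (ξ₃-increasing (3 ∸ m) (m+[n∸m]≡n (<⇒≤ m<3)) j≤m)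
  f3≡ξ₃mm : f3 (4 + m) ≡ ξ₃ m m
  f3≡ξ₃mm = f3-attained ≤-refl (proj₁ ∘ gap)

above-7 : ∀ {m k} → 3 < m → k ≤ m →
  ξ₃ m k ≤ f3 (4 + m) × f3 (4 + m) ≡ 3 * (4 + m) * (4 + m) + 30 ∸ 16 * (4 + m) × (ξ₃ m k ≡ f3 (4 + m) ⇔ k ≡ 0)
above-7 {m} {k} 3<m k≤m =
  subst (ξ₃ m k ≤_) (sym f3≡ξ₃m0) (proj₁ (gap k≤m)) , trans f3≡ξ₃m0 (ξ₃-0-closed m) , mk⇔
    (λ ξ≡f3 → to (proj₂ (gap k≤m)) (trans ξ≡f3 f3≡ξ₃m0))
    (λ k≡0 → trans (from (proj₂ (gap k≤m)) k≡0) (sym f3≡ξ₃m0))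
  where
  gap : ∀ {j} → j ≤ m → ξ₃ m j ≤ ξ₃ m 0 × (ξ₃ m j ≡ ξ₃ m 0 ⇔ j ≡ 0)
  gap {j} j≤m = +-*-gap j (m<n⇒0<n∸m 3<m) (ξ₃-decreasing (<⇒≤ 3<m) j≤m)
  f3≡ξ₃m0 : f3 (4 + m) ≡ ξ₃ m 0
  f3≡ξ₃m0 = f3-attained z≤n (proj₁ ∘ gap)

at-7 : ∀ {m k} → 4 + m ≡ 7 → k ≤ m → ξc (G 7 3 k) ≡ 65
at-7 {k = k} refl k≤3 = begin
  ξ₃ 3 k         ≡⟨ +-identityʳ (ξ₃ 3 k) ⟨
  ξ₃ 3 k + 0     ≡⟨ cong (ξ₃ 3 k +_) (*-zeroʳ k) ⟨
  ξ₃ 3 k + k * 0 ≡⟨ ξ₃-decreasing ≤-refl k≤3 ⟩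
  ξ₃ 3 0         ≡⟨ ξ₃-0 3 ⟩
  65             ∎
  where open ≡-Reasoning

corollary1 : (n k : ℕ) → 4 ≤ n → k ≤ n ∸ 4 →
    ((n < 7 → ξc (G n 3 k) ≤ f3 n × f3 n ≡ 2 * n * n + 2 ∸ 5 * n × (ξc (G n 3 k) ≡ f3 n ⇔ k ≡ n ∸ 4))
    × (7 < n → ξc (G n 3 k) ≤ f3 n × f3 n ≡ 3 * n * n + 30 ∸ 16 * n × (ξc (G n 3 k) ≡ f3 n ⇔ k ≡ 0))
    × (n ≡ 7 → ξc (G 7 3 k) ≡ 65))
corollary1 _ k (s≤s (s≤s (s≤s (s≤s (z≤n {n = m}))))) k≤m =
  (λ n<7 → below-7 (+-cancelˡ-< 4 m 3 n<7) k≤m) ,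
  (λ n>7 → above-7 (+-cancelˡ-< 4 3 m n>7) k≤m) ,
  (λ n≡7 → at-7 n≡7 k≤m)
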